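{- For all integers $k\ge2$, $n_1\ge2$ and $n_2,\ldots,n_k\ge1$, the digraph $Q'_{2n_1,\ldots,2n_k}$ is a transitive orientation of the graph $G'_{2n_1,\ldots,2n_k}$.
   Context: A transitive orientation of a graph $G$ is a transitive digraph on $V(G)$ obtained by replacing each edge $\{x,y\}$ of $G$ by exactly one of the arcs $(x,y),(y,x)$ (and no other arcs). For a digraph $D$, $D^\star$ is its dual (all arcs reversed). For $n\ge0$, $t_n(p)=p+n$, and $t_n(D)$ (resp. $t_n(G)$) is the copy with vertices shifted by $n$. Put $s_0=0$, $s_i=n_1+\cdots+n_i$. - $G_{2n}$: graph on $\{0,\ldots,2n-1\}$ with edges $\{2i,2j+1\}$, $0\le i\le j\le n-1$. - $G_{2n_1,\ldots,2n_k}$: graph on $\{0,\ldots,2s_k-1\}$ with edge set $\bigcup_{i=0}^{k-1}E(t_{2s_i}(G_{2n_{i+1}}))\cup\{\{2p-1,2q-1\}:1\le p\le n_1,\ n_1+1\le q\le s_k\}$. - $G'_{2n_1,\ldots,2n_k}$: same vertex set, edges $E(G_{2n_1,\ldots,2n_k})\cup\{\{2p-1,2q-1\}:1\le p<q\le n_1\}$. - $Q_{2n}$: digraph on $\{0,\ldots,2n-1\}$ with arcs $(2p,2q+1)$, $0\le p\le q\le n-1$. - $Q_{2n_1,\ldots,2n_k}$: digraph on $\{0,\ldots,2s_k-1\}$ with arcs $\bigcup_{i=1}^{k-1}A(t_{2s_i}((Q_{2n_{i+1}})^\star))\cup A(Q_{2n_1})\cup\{(2q-1,2p-1):1\le p\le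 n_1,\ n_1+1\le q\le s_k\}$. - $Q'_{2n_1,\ldots,2n_k}$: same vertex set, arcs $A(Q_{2n_1,\ldots,2n_k})\cup\{(2p-1,2q-1):1\le p<q\le n_1\}$. -}

module Defs where

open import Data.Nat using (ℕ; zero; suc; _+_; _*_; _∸_; _≤_; _<_)
open import Data.Product using (Σ; _×_)
open import Data.Sum using (_⊎_)
open import Data.Empty using (⊥)
open import Relation.Binary.PropositionalEquality using (_≡_)

-- A (di)graph on the vertex set {0,…,N-1} ⊆ ℕ is given by a relation on ℕ.
Rel : Set₁
Rel = ℕ → ℕ → Set

sym-closure : Rel → Rel
sym-closure R x y = R x y ⊎ R y x

shift : ℕ → Rel → Rel
shift m R x y = Σ ℕ λ a → Σ ℕ λ b → R a b × x ≡ a + m × y ≡ b + m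

dual : Rel → Rel
dual R x y = R y x

-- Pairs (2i, 2j+1) with 0 ≤ i ≤ j ≤ m-1.
-- As undirected edges this is E(G_{2m}); as arcs it is A(Q_{2m}).
block : ℕ → Rel
block m x y = Σ ℕ λ i → Σ ℕ λ j → i ≤ j × j < m × x ≡ 2 * i × y ≡ 2 * j + 1

G₂ : ℕ → Rel
G₂ m = sym-closure (block m)

Q₂ : ℕ → Rel
Q₂ m = block m

-- The parameters n₁,…,n_k are given by a function n : ℕ → ℕ (only n 1,…,n k matter).
-- s n i = n₁ + ⋯ + n_i
s : (ℕ → ℕ) → ℕ → ℕ
s n zero = 0
s n (suc i) = s n i + n (suc i)

cross : ℕ → (ℕ → ℕ) → Rel
cross k n x y = Σ ℕ λ p → Σ ℕ λ q →
  1 ≤ p × p ≤ n 1 × n 1 + 1 ≤ q × q ≤ s n k × x ≡ 2 * p ∸ 1 × y ≡ 2 * q ∸ 1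

inner : (ℕ → ℕ) → Rel
inner n x y = Σ ℕ λ p → Σ ℕ λ q →
  1 ≤ p × p < q × q ≤ n 1 × x ≡ 2 * p ∸ 1 × y ≡ 2 * q ∸ 1

G : ℕ → (ℕ → ℕ) → Rel
G k n x y =
  (Σ ℕ λ i → i < k × shift (2 * s n i) (G₂ (n (suc i))) x y)
  ⊎ sym-closure (cross k n) x y

G′ : ℕ → (ℕ → ℕ) → Rel
G′ k n x y = G k n x y ⊎ sym-closure (inner n) x y

Q : ℕ → (ℕ → ℕ) → Rel
Q k n x y =
  (Σ ℕ λ i → 1 ≤ i × i < k × shift (2 * s n i) (dual (Q₂ (n (suc i)))) x y)
  ⊎ Q₂ (n 1) x y
  ⊎ dual (cross k n) x y

Q′ : ℕ → (ℕ → ℕ) → Rel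
Q′ k n x y = Q k n x y ⊎ inner n x y

record IsTransitiveOrientation (N : ℕ) (E : Rel) (D : Rel) : Set where
  field
    arc-in-V   : ∀ {x y} → D x y → x < N × y < N
    arc-edge   : ∀ {x y} → D x y → E x y
    edge-arc   : ∀ {x y} → E x y → D x y ⊎ D y x
    not-both   : ∀ {x y} → D x y → D y x → ⊥
    transitive : ∀ {x y z} → D x y → D y z → D x z

-- Write the endpoints of every arc of Q′ as 2t or 2t + 1.  An arc of a reversed
-- later copy t_{2sᵢ}(Q_{2nᵢ₊₁}⋆) ends at an even vertex 2t with t ≥ n₁, and no arc
-- leaves such a vertex.  Every other arc ends at an odd vertex 2t + 1 with t < n₁,
-- and the only arcs leaving it are the arcs 2t + 1 → 2u + 1 (t < u < n₁) of the
-- transitive tournament added to Q.  Following an arc by such an arc gives an arc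
-- of the same kind as the first one, so Q′ is transitive; no arc is a loop, so
-- transitivity also excludes 2-cycles.
module Submission where

open import Defs
open import Data.Nat using (ℕ; zero; suc; _+_; _*_; _∸_; _≤_; _<_; z≤n; s≤s; _≤′_; ≤′-refl; ≤′-step)
open import Data.Nat.Properties
open import Data.Product using (Σ; _×_; _,_)
open import Data.Sum using (_⊎_; inj₁; inj₂)
open import Data.Empty using (⊥; ⊥-elim)
open import Function using (_∘_)
open import Relation.Binary.PropositionalEquality

even-index-unique : ∀ {x} a b → x ≡ 2 * a → x ≡ 2 * b → a ≡ b
even-index-unique a b x≡2a x≡2b = *-cancelˡ-≡ a b 2 (trans (sym x≡2a) x≡2b)

odd-index-unique : ∀ {x} a b → x ≡ 2 * a + 1 → x ≡ 2 * b + 1 → a ≡ b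
odd-index-unique a b x≡2a+1 x≡2b+1 =
  *-cancelˡ-≡ a b 2 (+-cancelʳ-≡ 1 (2 * a) (2 * b) (trans (sym x≡2a+1) x≡2b+1))

even≢odd-vertex : ∀ {x} a b → x ≡ 2 * a → x ≡ 2 * b + 1 → ⊥
even≢odd-vertex a b x≡2a x≡2b+1 =
  even≢odd a b (trans (sym x≡2a) (trans x≡2b+1 (+-comm (2 * b) 1)))

2*[1+p]∸1≡2*p+1 : ∀ p → 2 * suc p ∸ 1 ≡ 2 * p + 1
2*[1+p]∸1≡2*p+1 p = trans (cong (_∸ 1) (*-suc 2 p)) (+-comm 1 (2 * p))

2*[a+m]+1≡2*a+1+2*m : ∀ a m → 2 * (a + m) + 1 ≡ 2 * a + 1 + 2 * m
2*[a+m]+1≡2*a+1+2*m a m = begin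
  2 * (a + m) + 1     ≡⟨ cong (_+ 1) (*-distribˡ-+ 2 a m) ⟩
  2 * a + 2 * m + 1   ≡⟨ +-assoc (2 * a) (2 * m) 1 ⟩
  2 * a + (2 * m + 1) ≡⟨ cong (2 * a +_) (+-comm (2 * m) 1) ⟩
  2 * a + (1 + 2 * m) ≡⟨ +-assoc (2 * a) 1 (2 * m) ⟨
  2 * a + 1 + 2 * m   ∎
  where open ≡-Reasoning

2*-<-odd : ∀ {t u} → t < u → 2 * t + 1 < 2 * u
2*-<-odd {t} {u} t<u = subst (_≤ 2 * u) 2*[1+t]≡2+[2*t+1] (*-monoʳ-≤ 2 t<u)
  where
  2*[1+t]≡2+[2*t+1] : 2 * suc t ≡ suc (2 * t + 1)
  2*[1+t]≡2+[2*t+1] = trans (*-suc 2 t) (cong suc (+-comm 1 (2 * t)))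

m+1≤n⇒m<n : ∀ {m n} → m + 1 ≤ n → m < n
m+1≤n⇒m<n {m} {n} = subst (_≤ n) (+-comm m 1)

m<n⇒m+1≤n : ∀ {m n} → m < n → m + 1 ≤ n
m<n⇒m+1≤n {m} {n} = subst (_≤ n) (+-comm 1 m)

s-mono-≤ : ∀ (n : ℕ → ℕ) {i j} → i ≤ j → s n i ≤ s n j
s-mono-≤ n = go ∘ ≤⇒≤′
  where
  go : ∀ {i j} → i ≤′ j → s n i ≤ s n j
  go ≤′-refl = ≤-refl
  go (≤′-step {j} i≤′j) = ≤-trans (go i≤′j) (m≤m+n (s n j) (n (suc j)))

module _ (k : ℕ) (n : ℕ → ℕ) where

  -- Q′ with every endpoint written as 2t or 2t + 1.  The endpoints are fixed by equations
  -- rather than indices because pattern matching cannot unify 2 * a with 2 * b + 1.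
  data Arc (x y : ℕ) : Set where
    dual-block-arc : ∀ i a b → 1 ≤ i → i < k → a ≤ b → b < n (suc i) →
      x ≡ 2 * (b + s n i) + 1 → y ≡ 2 * (a + s n i) → Arc x y
    block-arc : ∀ a b → a ≤ b → b < n 1 →
      x ≡ 2 * a → y ≡ 2 * b + 1 → Arc x y
    cross-arc : ∀ a b → a < n 1 → n 1 ≤ b → b < s n k →
      x ≡ 2 * b + 1 → y ≡ 2 * a + 1 → Arc x y
    inner-arc : ∀ a b → a < b → b < n 1 →
      x ≡ 2 * a + 1 → y ≡ 2 * b + 1 → Arc x y

  Q′⇒Arc : ∀ {x y} → Q′ k n x y → Arc x y
  Q′⇒Arc (inj₁ (inj₁ (i , 1≤i , i<k , _ , _ , (a , b , a≤b , b<nᵢ , refl , refl) , x≡ , y≡))) =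
    dual-block-arc i a b 1≤i i<k a≤b b<nᵢ
      (trans x≡ (sym (2*[a+m]+1≡2*a+1+2*m b (s n i))))
      (trans y≡ (sym (*-distribˡ-+ 2 a (s n i))))
  Q′⇒Arc (inj₁ (inj₂ (inj₁ (a , b , a≤b , b<n₁ , x≡ , y≡)))) = block-arc a b a≤b b<n₁ x≡ y≡
  Q′⇒Arc (inj₁ (inj₂ (inj₂ (suc a , suc b , _ , a<n₁ , n₁+1≤1+b , b<sₖ , y≡ , x≡)))) =
    cross-arc a b a<n₁ (≤-pred (m+1≤n⇒m<n n₁+1≤1+b)) b<sₖ
      (trans x≡ (2*[1+p]∸1≡2*p+1 b)) (trans y≡ (2*[1+p]∸1≡2*p+1 a))
  Q′⇒Arc (inj₁ (inj₂ (inj₂ (_ , zero , _ , _ , n₁+1≤0 , _)))) = ⊥-elim (n≮0 (m+1≤n⇒m<n n₁+1≤0))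
  Q′⇒Arc (inj₂ (suc a , suc b , _ , 1+a<1+b , b<n₁ , x≡ , y≡)) =
    inner-arc a b (≤-pred 1+a<1+b) b<n₁
      (trans x≡ (2*[1+p]∸1≡2*p+1 a)) (trans y≡ (2*[1+p]∸1≡2*p+1 b))

  Arc⇒Q′ : ∀ {x y} → Arc x y → Q′ k n x y
  Arc⇒Q′ (dual-block-arc i a b 1≤i i<k a≤b b<nᵢ x≡ y≡) =
    inj₁ (inj₁ (i , 1≤i , i<k , 2 * b + 1 , 2 * a , (a , b , a≤b , b<nᵢ , refl , refl) ,
      trans x≡ (2*[a+m]+1≡2*a+1+2*m b (s n i)) , trans y≡ (*-distribˡ-+ 2 a (s n i))))
  Arc⇒Q′ (block-arc a b a≤b b<n₁ x≡ y≡) = inj₁ (inj₂ (inj₁ (a , b , a≤b , b<n₁ , x≡ , y≡)))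
  Arc⇒Q′ (cross-arc a b a<n₁ n₁≤b b<sₖ x≡ y≡) =
    inj₁ (inj₂ (inj₂ (suc a , suc b , s≤s z≤n , a<n₁ , m<n⇒m+1≤n (s≤s n₁≤b) , b<sₖ ,
      trans y≡ (sym (2*[1+p]∸1≡2*p+1 a)) , trans x≡ (sym (2*[1+p]∸1≡2*p+1 b)))))
  Arc⇒Q′ (inner-arc a b a<b b<n₁ x≡ y≡) =
    inj₂ (suc a , suc b , s≤s z≤n , s≤s a<b , b<n₁ ,
      trans x≡ (sym (2*[1+p]∸1≡2*p+1 a)) , trans y≡ (sym (2*[1+p]∸1≡2*p+1 b)))

  arc-from-small-odd : ∀ {y z} t → Arc y z → y ≡ 2 * t + 1 → t < n 1 →
    Σ ℕ λ u → t < u × u < n 1 × z ≡ 2 * u + 1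
  arc-from-small-odd t (dual-block-arc i _ b 1≤i _ _ _ y≡ _) y≡2t+1 t<n₁ =
    ⊥-elim (<⇒≱ t<n₁ (begin
      n 1       ≤⟨ s-mono-≤ n 1≤i ⟩
      s n i     ≤⟨ m≤n+m (s n i) b ⟩
      b + s n i ≡⟨ odd-index-unique (b + s n i) t y≡ y≡2t+1 ⟩
      t         ∎))
    where open ≤-Reasoning
  arc-from-small-odd t (block-arc a _ _ _ y≡ _) y≡2t+1 _ = ⊥-elim (even≢odd-vertex a t y≡ y≡2t+1)
  arc-from-small-odd t (cross-arc _ b _ n₁≤b _ y≡ _) y≡2t+1 t<n₁ =
    ⊥-elim (<⇒≱ t<n₁ (≤-trans n₁≤b (≤-reflexive (odd-index-unique b t y≡ y≡2t+1))))
  arc-from-small-odd t (inner-arc a b a<b b<n₁ y≡ z≡) y≡2t+1 _ =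
    b , subst (_< b) (odd-index-unique a t y≡ y≡2t+1) a<b , b<n₁ , z≡

  no-arc-from-large-even : ∀ {y z} t → Arc y z → y ≡ 2 * t → n 1 ≤ t → ⊥
  no-arc-from-large-even t (dual-block-arc i _ b _ _ _ _ y≡ _) y≡2t _ =
    even≢odd-vertex t (b + s n i) y≡2t y≡
  no-arc-from-large-even t (block-arc a _ a≤b b<n₁ y≡ _) y≡2t n₁≤t =
    <⇒≱ (≤-<-trans a≤b b<n₁) (≤-trans n₁≤t (≤-reflexive (even-index-unique t a y≡2t y≡)))
  no-arc-from-large-even t (cross-arc _ b _ _ _ y≡ _) y≡2t _ = even≢odd-vertex t b y≡2t y≡
  no-arc-from-large-even t (inner-arc a _ _ _ y≡ _) y≡2t _ = even≢odd-vertex t a y≡2t y≡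

  Arc-trans : ∀ {x y z} → Arc x y → Arc y z → Arc x z
  Arc-trans (dual-block-arc i a _ 1≤i _ _ _ _ y≡) yz =
    ⊥-elim (no-arc-from-large-even (a + s n i) yz y≡
      (≤-trans (s-mono-≤ n 1≤i) (m≤n+m (s n i) a)))
  Arc-trans (block-arc a b a≤b b<n₁ x≡ y≡) yz with arc-from-small-odd b yz y≡ b<n₁
  ... | c , b<c , c<n₁ , z≡ = block-arc a c (≤-trans a≤b (<⇒≤ b<c)) c<n₁ x≡ z≡
  Arc-trans (cross-arc a b a<n₁ n₁≤b b<sₖ x≡ y≡) yz with arc-from-small-odd a yz y≡ a<n₁
  ... | c , _ , c<n₁ , z≡ = cross-arc c b c<n₁ n₁≤b b<sₖ x≡ z≡
  Arc-trans (inner-arc a b a<b b<n₁ x≡ y≡) yz with arc-from-small-odd b yz y≡ b<n₁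
  ... | c , b<c , c<n₁ , z≡ = inner-arc a c (<-trans a<b b<c) c<n₁ x≡ z≡

  Arc-irrefl : ∀ {x} → Arc x x → ⊥
  Arc-irrefl (dual-block-arc i a b _ _ _ _ x≡odd x≡even) =
    even≢odd-vertex (a + s n i) (b + s n i) x≡even x≡odd
  Arc-irrefl (block-arc a b _ _ x≡even x≡odd) = even≢odd-vertex a b x≡even x≡odd
  Arc-irrefl (cross-arc a b a<n₁ n₁≤b _ x≡2b+1 x≡2a+1) =
    >⇒≢ (<-≤-trans a<n₁ n₁≤b) (odd-index-unique b a x≡2b+1 x≡2a+1)
  Arc-irrefl (inner-arc a b a<b _ x≡2a+1 x≡2b+1) = <⇒≢ a<b (odd-index-unique a b x≡2a+1 x≡2b+1)

  Arc-in-range : 1 ≤ k → ∀ {x y} → Arc x y → x < 2 * s n k × y < 2 * s n k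
  Arc-in-range _ (dual-block-arc i a b _ i<k a≤b b<nᵢ refl refl) =
    2*-<-odd b+sᵢ<sₖ , *-monoʳ-< 2 (≤-<-trans (+-monoˡ-≤ (s n i) a≤b) b+sᵢ<sₖ)
    where
    b+sᵢ<sₖ : b + s n i < s n k
    b+sᵢ<sₖ = begin-strict
      b + s n i          <⟨ +-monoˡ-< (s n i) b<nᵢ ⟩
      n (suc i) + s n i  ≡⟨ +-comm (n (suc i)) (s n i) ⟩
      s n (suc i)        ≤⟨ s-mono-≤ n i<k ⟩
      s n k              ∎
      where open ≤-Reasoning
  Arc-in-range 1≤k (block-arc _ b a≤b b<n₁ refl refl) =
    *-monoʳ-< 2 (≤-<-trans a≤b b<sₖ) , 2*-<-odd b<sₖ
    where
    b<sₖ : b < s n k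
    b<sₖ = <-≤-trans b<n₁ (s-mono-≤ n 1≤k)
  Arc-in-range 1≤k (cross-arc _ _ a<n₁ _ b<sₖ refl refl) =
    2*-<-odd b<sₖ , 2*-<-odd (<-≤-trans a<n₁ (s-mono-≤ n 1≤k))
  Arc-in-range 1≤k (inner-arc _ b a<b b<n₁ refl refl) =
    2*-<-odd (<-trans a<b b<sₖ) , 2*-<-odd b<sₖ
    where
    b<sₖ : b < s n k
    b<sₖ = <-≤-trans b<n₁ (s-mono-≤ n 1≤k)

  Q′⊆G′ : 1 ≤ k → ∀ {x y} → Q′ k n x y → G′ k n x y
  Q′⊆G′ _ (inj₁ (inj₁ (i , _ , i<k , a , b , blk , x≡ , y≡))) =
    inj₁ (inj₁ (i , i<k , a , b , inj₂ blk , x≡ , y≡))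
  Q′⊆G′ 1≤k {x} {y} (inj₁ (inj₂ (inj₁ blk))) =
    inj₁ (inj₁ (0 , 1≤k , x , y , inj₁ blk , sym (+-identityʳ x) , sym (+-identityʳ y)))
  Q′⊆G′ _ (inj₁ (inj₂ (inj₂ c))) = inj₁ (inj₂ (inj₂ c))
  Q′⊆G′ _ (inj₂ d) = inj₂ (inj₁ d)

  G′⊆Q′∪Q′⁻¹ : ∀ {x y} → G′ k n x y → Q′ k n x y ⊎ Q′ k n y x
  G′⊆Q′∪Q′⁻¹ (inj₁ (inj₁ (zero , _ , a , b , inj₁ blk , x≡ , y≡))) =
    inj₁ (inj₁ (inj₂ (inj₁ (subst₂ (block (n 1))
      (sym (trans x≡ (+-identityʳ a))) (sym (trans y≡ (+-identityʳ b))) blk))))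
  G′⊆Q′∪Q′⁻¹ (inj₁ (inj₁ (zero , _ , a , b , inj₂ blk , x≡ , y≡))) =
    inj₂ (inj₁ (inj₂ (inj₁ (subst₂ (block (n 1))
      (sym (trans y≡ (+-identityʳ b))) (sym (trans x≡ (+-identityʳ a))) blk))))
  G′⊆Q′∪Q′⁻¹ (inj₁ (inj₁ (suc i , i<k , a , b , inj₁ blk , x≡ , y≡))) =
    inj₂ (inj₁ (inj₁ (suc i , s≤s z≤n , i<k , b , a , blk , y≡ , x≡)))
  G′⊆Q′∪Q′⁻¹ (inj₁ (inj₁ (suc i , i<k , a , b , inj₂ blk , x≡ , y≡))) =
    inj₁ (inj₁ (inj₁ (suc i , s≤s z≤n , i<k , a , b , blk , x≡ , y≡)))
  G′⊆Q′∪Q′⁻¹ (inj₁ (inj₂ (inj₁ c))) = inj₂ (inj₁ (inj₂ (inj₂ c)))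
  G′⊆Q′∪Q′⁻¹ (inj₁ (inj₂ (inj₂ c))) = inj₁ (inj₁ (inj₂ (inj₂ c)))
  G′⊆Q′∪Q′⁻¹ (inj₂ (inj₁ d)) = inj₁ (inj₂ d)
  G′⊆Q′∪Q′⁻¹ (inj₂ (inj₂ d)) = inj₂ (inj₂ d)

  Q′-trans : ∀ {x y z} → Q′ k n x y → Q′ k n y z → Q′ k n x z
  Q′-trans xy yz = Arc⇒Q′ (Arc-trans (Q′⇒Arc xy) (Q′⇒Arc yz))

  Q′-asym : ∀ {x y} → Q′ k n x y → Q′ k n y x → ⊥
  Q′-asym xy yx = Arc-irrefl (Arc-trans (Q′⇒Arc xy) (Q′⇒Arc yx))

mainTheorem4 : (k : ℕ) (n : ℕ → ℕ) → 2 ≤ k → 2 ≤ n 1 →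
    (∀ i → 2 ≤ i → i ≤ k → 1 ≤ n i) →
    IsTransitiveOrientation (2 * s n k) (G′ k n) (Q′ k n)
mainTheorem4 k n 2≤k _ _ = record
  { arc-in-V   = Arc-in-range k n 1≤k ∘ Q′⇒Arc k n
  ; arc-edge   = Q′⊆G′ k n 1≤k
  ; edge-arc   = G′⊆Q′∪Q′⁻¹ k n
  ; not-both   = Q′-asym k n
  ; transitive = Q′-trans k n
  }
  where
  1≤k : 1 ≤ k
  1≤k = ≤-trans (s≤s z≤n) 2≤k
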